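{- Let $P\subseteq\mathit{Act}^\omega$ be a set of infinite traces. Consider a monitor $M$ given abstractly by two sets $L_a,L_r\subseteq\mathit{Act}^*$ of finite traces that it accepts and rejects, respectively, such that verdicts are irrevocable (if $s\in L_a$ then $ss'\in L_a$ for all $s'\in\mathit{Act}^*$, and likewise for $L_r$), and say that $M$ accepts (resp. rejects) $t\in\mathit{Act}^\omega$ iff some finite prefix of $t$ lies in $L_a$ (resp. $L_r$). If $M$ is sound and complete for $P$, i.e. for all $t\in\mathit{Act}^\omega$: $M$ accepts $t$ implies $t\in P$, $M$ rejects $t$ implies $t\notin P$, $t\in P$ implies $M$ accepts $t$, and $t\notin P$ implies $M$ rejects $t$, then there is a formula $\varphi\in\mathrm{HML}$ with $[\![\varphi]\!]_L=P$.
   Context: $\mathit{Act}$ is a fixed finite set of actions. $\mathrm{HML}$ is the fixpoint-free fragment of recHML: $\varphi::=\mathrm{tt}\mid\mathrm{ff}\mid\varphi\vee\varphi\mid\varphi\wedge\varphi\mid\langle A\rangle\varphi\mid[A]\varphi$ with $A\subseteq\mathit{Act}$. Linear-time semantics over $\mathit{Act}^\omega$: $[\![\mathrm{tt}]\!]_L=\mathit{Act}^\omega$, $[\![\mathrm{ff}]\!]_L=\emptyset$, $\vee,\wedge$ union/intersection, $[\![\langle A\rangle\varphi]\!]_L=\{at\mid a\in A,t\in[\![\varphi]\!]_L\}$, $[\![[A]\varphi]\!]_L=\{t\mid\forall a\in A,\forall t'.\ t=at'\Rightarrow t'\in[\![\varphi]\!]_L\}$. -}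

module Defs where

open import Data.Nat using (ℕ; zero; suc)
open import Data.Fin using (Fin)
open import Data.Fin.Subset using (Subset; _∈_)
open import Data.List using (List; []; _∷_; _++_)
open import Data.Product using (Σ; _×_; ∃)
open import Data.Sum using (_⊎_)
open import Data.Unit using (⊤)
open import Data.Empty using (⊥)
open import Relation.Nullary using (¬_)

-- Act = Fin n (a fixed finite set of actions); A ⊆ Act is a Subset n.
-- Infinite traces Act^ω:
Trace : ℕ → Set
Trace n = ℕ → Fin n

FTrace : ℕ → Set
FTrace n = List (Fin n)

tail : ∀ {n} → Trace n → Trace n
tail t k = t (suc k)

prefix : ∀ {n} → Trace n → ℕ → FTrace n
prefix t zero = []
prefix t (suc k) = t 0 ∷ prefix (tail t) k

data HML (n : ℕ) : Set where
  tt ff : HML n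
  _∨_ _∧_ : HML n → HML n → HML n
  ⟨_⟩_ : Subset n → HML n → HML n
  [_]_ : Subset n → HML n → HML n

⟦_⟧ : ∀ {n} → HML n → Trace n → Set
⟦ tt ⟧ t = ⊤
⟦ ff ⟧ t = ⊥
⟦ φ ∨ ψ ⟧ t = ⟦ φ ⟧ t ⊎ ⟦ ψ ⟧ t
⟦ φ ∧ ψ ⟧ t = ⟦ φ ⟧ t × ⟦ ψ ⟧ t
⟦ ⟨ A ⟩ φ ⟧ t = t 0 ∈ A × ⟦ φ ⟧ (tail t)
⟦ [ A ] φ ⟧ t = t 0 ∈ A → ⟦ φ ⟧ (tail t)

Irrevocable : ∀ {n} → (FTrace n → Set) → Set
Irrevocable L = ∀ s s' → L s → L (s ++ s')

Verdict : ∀ {n} → (FTrace n → Set) → Trace n → Set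
Verdict L t = ∃ λ k → L (prefix t k)

SoundComplete : ∀ {n} → (Trace n → Set) → (FTrace n → Set) → (FTrace n → Set) → Set
SoundComplete P La Lr =
  (∀ t → Verdict La t → P t) ×
  (∀ t → Verdict Lr t → ¬ P t) ×
  (∀ t → P t → Verdict La t) ×
  (∀ t → ¬ P t → Verdict Lr t)

-- Irrevocability makes "a verdict by step k" monotone in k. Since every trace
-- eventually gets a verdict, König's lemma for the finitely branching tree of
-- finite traces (classically: without a uniform bound there is an infinite
-- verdict-free branch) gives a single depth K at which every trace already has
-- a verdict. Soundness then makes P t equivalent to acceptance of the length-K
-- prefix of t, and any predicate of length-K prefixes is expressed by a formula
-- of box-depth K that branches on each letter a with [a].
module Submission where

open import Defs
open import Data.Nat using (ℕ; zero; suc; _≤_; s≤s)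
open import Data.Fin using (Fin)
open import Data.Fin.Subset using (⁅_⁆; _∈_)
open import Data.Fin.Subset.Properties using (x∈⁅x⁆; x∈⁅y⁆⇒x≡y)
open import Data.List using ([]; _∷_; _++_; map; allFin)
open import Data.List.Extrema.Nat using (max; xs≤max)
open import Data.List.Membership.Propositional.Properties using (∈-allFin)
open import Data.List.Relation.Unary.All as All using ()
open import Data.List.Relation.Unary.All.Properties using (map⁻)
open import Data.Product using (Σ; _×_; _,_; proj₁; proj₂; ∃)
open import Data.Sum using (inj₁; inj₂)
open import Data.Unit using (tt)
open import Data.Empty using (⊥-elim)
open import Function using (const)
open import Function.Bundles using (_⇔_; mk⇔; Equivalence)
import Function.Properties.Equivalence as ⇔
open import Axiom.ExcludedMiddle using (ExcludedMiddle)
open import Level using (0ℓ)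
open import Relation.Nullary using (¬_; Dec; yes; no)
open import Relation.Nullary.Decidable using (decidable-stable)
open import Relation.Unary using (_∪_)
open import Relation.Binary.PropositionalEquality using (_≡_; refl; cong; subst; sym)

module _ {n : ℕ} where

  _Defines_ : HML n → (Trace n → Set) → Set
  φ Defines P = ∀ t → ⟦ φ ⟧ t ⇔ P t

  Residual : Fin n → (FTrace n → Set) → FTrace n → Set
  Residual a Q s = Q (a ∷ s)

  fromDec : {X : Set} → Dec X → HML n
  fromDec (yes _) = tt
  fromDec (no _)  = ff

  fromDec-defines : {X : Set} (d : Dec X) → fromDec d Defines const X
  fromDec-defines (yes x) t = mk⇔ (const x) (const tt)
  fromDec-defines (no ¬x) t = mk⇔ (λ ()) ¬x

  ⋀ : ∀ {m} → (Fin m → HML n) → HML n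
  ⋀ {zero}  φ = tt
  ⋀ {suc m} φ = φ Fin.zero ∧ ⋀ (λ i → φ (Fin.suc i))

  ⟦⋀⟧ : ∀ {m} (φ : Fin m → HML n) t → ⟦ ⋀ φ ⟧ t ⇔ (∀ i → ⟦ φ i ⟧ t)
  ⟦⋀⟧ {zero}  φ t = mk⇔ (λ _ ()) (const tt)
  ⟦⋀⟧ {suc m} φ t = mk⇔ to from
    where
    rest = ⟦⋀⟧ (λ i → φ (Fin.suc i)) t
    to : ⟦ ⋀ φ ⟧ t → ∀ i → ⟦ φ i ⟧ t
    to (φ₀ , _)  Fin.zero    = φ₀
    to (_  , φₛ) (Fin.suc i) = Equivalence.to rest φₛ i
    from : (∀ i → ⟦ φ i ⟧ t) → ⟦ ⋀ φ ⟧ t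
    from h = h Fin.zero , Equivalence.from rest (λ i → h (Fin.suc i))

  caseHead : (Fin n → HML n) → HML n
  caseHead φ = ⋀ λ a → [ ⁅ a ⁆ ] φ a

  ⟦caseHead⟧ : ∀ φ t → ⟦ caseHead φ ⟧ t ⇔ ⟦ φ (t 0) ⟧ (tail t)
  ⟦caseHead⟧ φ t = ⇔.trans (⟦⋀⟧ _ t) (mk⇔ (λ h → h (t 0) (x∈⁅x⁆ (t 0))) from)
    where
    from : ⟦ φ (t 0) ⟧ (tail t) → ∀ a → t 0 ∈ ⁅ a ⁆ → ⟦ φ a ⟧ (tail t)
    from h a t₀∈a = subst (λ b → ⟦ φ b ⟧ (tail t)) (x∈⁅y⁆⇒x≡y a t₀∈a) h

  prefixFormula : ExcludedMiddle 0ℓ → (FTrace n → Set) → ℕ → HML n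
  prefixFormula lem Q zero    = fromDec (lem {Q []})
  prefixFormula lem Q (suc k) = caseHead λ a → prefixFormula lem (Residual a Q) k

  prefixFormula-defines : ∀ (lem : ExcludedMiddle 0ℓ) Q k →
                          prefixFormula lem Q k Defines (λ t → Q (prefix t k))
  prefixFormula-defines lem Q zero    = fromDec-defines (lem {Q []})
  prefixFormula-defines lem Q (suc k) t =
    ⇔.trans (⟦caseHead⟧ _ t) (prefixFormula-defines lem (Residual (t 0) Q) k (tail t))

  UniformlyReached : (FTrace n → Set) → Set
  UniformlyReached Q = ∃ λ K → ∀ t → Q (prefix t K)

  prefix-extends : ∀ (t : Trace n) {k k′} → k ≤ k′ → ∃ λ u → prefix t k′ ≡ prefix t k ++ u
  prefix-extends t {zero}  {k′}     _         = prefix t k′ , refl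
  prefix-extends t {suc k} {suc k′} (s≤s k≤k′) =
    let u , eq = prefix-extends (tail t) k≤k′ in u , cong (t 0 ∷_) eq

  Irrevocable-prefix : ∀ {Q} → Irrevocable Q → ∀ t {k k′} → k ≤ k′ →
                       Q (prefix t k) → Q (prefix t k′)
  Irrevocable-prefix {Q} irr t k≤k′ q =
    let u , eq = prefix-extends t k≤k′ in subst Q (sym eq) (irr _ u q)

  Residual-irrevocable : ∀ {Q} a → Irrevocable Q → Irrevocable (Residual a Q)
  Residual-irrevocable a irr s = irr (a ∷ s)

  Irrevocable-∪ : {L L′ : FTrace n → Set} → Irrevocable L → Irrevocable L′ → Irrevocable (L ∪ L′)
  Irrevocable-∪ irr irr′ s u (inj₁ l)  = inj₁ (irr s u l)
  Irrevocable-∪ irr irr′ s u (inj₂ l′) = inj₂ (irr′ s u l′)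

  upperBound : ∀ {m} (f : Fin m → ℕ) → ∃ λ M → ∀ i → f i ≤ M
  upperBound {m} f = max 0 (map f (allFin m)) ,
    λ i → All.lookup (map⁻ (xs≤max 0 (map f (allFin m)))) (∈-allFin i)

  uniform-cons : ∀ {Q} → Irrevocable Q → (∀ a → UniformlyReached (Residual a Q)) →
                 UniformlyReached Q
  uniform-cons {Q} irr reached = suc M , λ t →
    Irrevocable-prefix (Residual-irrevocable (t 0) irr) (tail t) (K≤M (t 0))
      (proj₂ (reached (t 0)) (tail t))
    where
    M = proj₁ (upperBound (λ a → proj₁ (reached a)))
    K≤M = proj₂ (upperBound (λ a → proj₁ (reached a)))

  module _ (lem : ExcludedMiddle 0ℓ) where

    escape : ∀ {Q} → Irrevocable Q → ¬ UniformlyReached Q →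
             ∃ λ a → ¬ UniformlyReached (Residual a Q)
    escape irr ¬reached = decidable-stable lem λ ¬escape →
      ¬reached (uniform-cons irr λ a → decidable-stable lem λ ¬r → ¬escape (a , ¬r))

    escapingTrace : ∀ Q → Irrevocable Q → ¬ UniformlyReached Q → Trace n
    escapingTrace Q irr ¬reached zero    = proj₁ (escape irr ¬reached)
    escapingTrace Q irr ¬reached (suc i) =
      let a , ¬reached′ = escape irr ¬reached
      in escapingTrace (Residual a Q) (Residual-irrevocable a irr) ¬reached′ i

    escapingTrace-avoids : ∀ {Q} (irr : Irrevocable Q) (¬reached : ¬ UniformlyReached Q) k →
                            ¬ Q (prefix (escapingTrace Q irr ¬reached) k)
    escapingTrace-avoids irr ¬reached zero    q = ¬reached (0 , λ _ → q)
    escapingTrace-avoids irr ¬reached (suc k) q =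
      let a , ¬reached′ = escape irr ¬reached
      in escapingTrace-avoids (Residual-irrevocable a irr) ¬reached′ k q

    königsLemma : ∀ {Q} → Irrevocable Q → (∀ t → Verdict Q t) → UniformlyReached Q
    königsLemma {Q} irr verdict = decidable-stable lem λ ¬reached →
      let k , q = verdict (escapingTrace Q irr ¬reached)
      in escapingTrace-avoids irr ¬reached k q

    acceptanceDepth : ∀ {P La Lr} → Irrevocable La → Irrevocable Lr → SoundComplete P La Lr →
                      ∃ λ K → ∀ t → P t ⇔ La (prefix t K)
    acceptanceDepth {P} {La} {Lr} irrA irrR (soundA , soundR , completeA , completeR) =
      K , λ t → mk⇔ (accepted t (reached t)) (λ q → soundA t (K , q))
      where
      verdict : ∀ t → Verdict (La ∪ Lr) t
      verdict t with lem {P t}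
      ... | yes p = let k , a = completeA t p in k , inj₁ a
      ... | no ¬p = let k , r = completeR t ¬p in k , inj₂ r
      decided : UniformlyReached (La ∪ Lr)
      decided = königsLemma (Irrevocable-∪ irrA irrR) verdict
      K = proj₁ decided
      reached = proj₂ decided
      accepted : ∀ t → (La ∪ Lr) (prefix t K) → P t → La (prefix t K)
      accepted t (inj₁ a) p = a
      accepted t (inj₂ r) p = ⊥-elim (soundR t (K , r) p)

mainTheorem16 : ExcludedMiddle 0ℓ →
    (n : ℕ) (P : Trace n → Set) (La Lr : FTrace n → Set) →
    Irrevocable La → Irrevocable Lr →
    SoundComplete P La Lr →
    Σ (HML n) λ φ → ∀ t → (⟦ φ ⟧ t → P t) × (P t → ⟦ φ ⟧ t)
mainTheorem16 lem n P La Lr irrA irrR sc =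
  prefixFormula lem La K , λ t →
    let φ⇔P = ⇔.trans (prefixFormula-defines lem La K t) (⇔.sym (P⇔La t))
    in Equivalence.to φ⇔P , Equivalence.from φ⇔P
  where
  K = proj₁ (acceptanceDepth lem irrA irrR sc)
  P⇔La = proj₂ (acceptanceDepth lem irrA irrR sc)
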